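{- Let $\mathit{At}=\{a_1,\dots,a_n\}$ be a finite set of atoms and $\mathbb{L}$ a propositional definite logic program over $\mathit{At}$. Let $E_{\mathbb{L}}$ be the immediate consequence diagram and $D_{\mathbb{L}}$ the consequence diagram of $\mathbb{L}$ (see context). Then the monotone relation $[\![E_{\mathbb{L}}]\!]$ represents the immediate consequence operator $T_{\mathbb{L}}$, and the monotone relation $[\![D_{\mathbb{L}}]\!]$ represents the consequence operator $C_{\mathbb{L}}$.
   Context: $\mathbb{B}=\{0,1\}$ with $0\le 1$; $\mathbb{B}^{\mathit{At}}$ (interpretations $\mathcal{I}:\mathit{At}\to\mathbb{B}$) is ordered pointwise, and $\land,\lor,\mathbf{0},\mathbf{1}$ on $\mathbb{B}^{\mathit{At}}$ are pointwise. A Horn clause is $b_1,\dots,b_k\to a$ with $a,b_1,\dots,b_k\in\mathit{At}$ and the $b_i$ distinct; $a$ is its head, $\{b_1,\dots,b_k\}$ its body (possibly empty). A propositional definite logic program is a finite set of Horn clauses. Its immediate consequence operator $T_{\mathbb{L}}:\mathbb{B}^{\mathit{At}}\to\mathbb{B}^{\mathit{At}}$ is $T_{\mathbb{L}}(\mathcal{I})(a)=1$ iff there is a clause of $\mathbb{L}$ with head $a$ and body $\{b_1,\dots,b_k\}$ with $\mathcal{I}(b_1)=\dots=\mathcal{I}(b_k)=1$. The least Herbrand model of $\mathbb{L}$ is the least fixed point of $T_{\mathbb{L}}$; the consequence operator $C_{\mathbb{L}}(\mathcal{I})$ is the least Herbrand model of $\mathbb{L}\cup\{\to a\mid \mathcal{I}(a)=1\}$.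 A relation $R\subseteq X\times Y$ between posets represents a monotone function $f:X\to Y$ if for all $x\in X,y\in Y$: $(x,y)\in R$ iff $f(x)\le y$. Diagrams are interpreted as relations: sequential composition is relational composition $R;S=\{(x,z)\mid\exists y,(x,y)\in R,(y,z)\in S\}$, parallel composition is product. Interpretations of the building blocks: a $k$-ary copier $1\to k$ is $\{(x,(y_1,\dots,y_k))\mid x\le y_l\ \forall l\}$ (for $k=0$ this is $\mathbb{B}\times\{\bullet\}$, for $k=1$ the order $\le$); a $k$-ary conjunction node $k\to1$ is $\{((x_1,\dots,x_k),y)\mid x_1\land\dots\land x_k\le y\}$ (for $k=0$: $\{(\bullet,1)\}$); an $\ell$-ary co-copier $\ell\to 1$ is $\{((x_1,\dots,x_\ell),y)\mid x_r\le y\ \forall r\}$ (for $\ell=0$: $\{\bullet\}\times\mathbb{B}$); wire permutations are permutations of coordinates. The immediate consequence diagram $E_{\mathbb{L}}:n\to n$ (wire $i$ on each side stands for $a_i$; clauses $\psi_1,\dots,\psi_q$) is: each input wire $i$ is copied by a $k_i$-ary copier, $k_i$ the number of clauses whose body contains $a_i$; for each clause $\psi_j$ there is an $m_j$-ary conjunction node, $m_j=|\mathrm{body}(\psi_j)|$, receiving one copy of input wire $i$ for each $a_i\in\mathrm{body}(\psi_j)$; output wire $i$ is the output of an $\ell_i$-ary co-copier, $\ell_i$ the number of clauses with head $a_i$, whose inputs are the outputs of the conjunction nodes of the clauses with head $a_i$. The consequence diagram $D_{\mathbb{L}}:n\to n$ adds a feedback loop to $E_{\mathbb{L}}$; its interpretation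 is $[\![D_{\mathbb{L}}]\!]=\{(\mathcal{I},\mathcal{J})\mid \exists \mathcal{K}_1,\dots,\mathcal{K}_6\in\mathbb{B}^{\mathit{At}}:\ \mathcal{I}\le\mathcal{K}_1,\ \mathcal{K}_6\le\mathcal{K}_1,\ \mathcal{K}_1\le\mathcal{K}_2,\ \mathcal{K}_1\le\mathcal{J},\ (\mathcal{K}_2,\mathcal{K}_3)\in[\![E_{\mathbb{L}}]\!],\ \mathcal{K}_3\land\mathcal{K}_4\le\mathbf{0},\ \mathcal{K}_5\le\mathcal{K}_4,\ \mathbf{1}\le\mathcal{K}_5\lor\mathcal{K}_6\}$. -}

module Defs where

open import Data.Nat using (ℕ; zero; suc)
open import Data.Fin using (Fin; zero; suc; _≟_)
open import Data.Bool using (Bool; true; false; _∧_; _∨_; not; T)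
open import Data.Bool.Base public using (_≤_)
open import Data.List using (List; []; _∷_; length; map; filterᵇ; _++_)
open import Data.List.Base using (lookup)
open import Data.Fin.Base using () 
open import Data.List.Base using ()
open import Data.Product using (Σ; _×_; ∃; ∃-syntax)
open import Function.Definitions using (Injective)
open import Function.Bundles using (_⇔_)
open import Relation.Binary.PropositionalEquality using (_≡_)
open import Relation.Nullary.Decidable using (⌊_⌋)
open import Data.List using (upTo)
import Data.List.Base as L

Interp : ℕ → Set
Interp n = Fin n → Bool

_≤ᴵ_ : ∀ {n} → Interp n → Interp n → Set
I ≤ᴵ J = ∀ a → I a ≤ J a

_∧ᴵ_ : ∀ {n} → Interp n → Interp n → Interp n
(I ∧ᴵ J) a = I a ∧ J a

_∨ᴵ_ : ∀ {n} → Interp n → Interp n → Interp n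
(I ∨ᴵ J) a = I a ∨ J a

𝟎 : ∀ {n} → Interp n
𝟎 _ = false

𝟏 : ∀ {n} → Interp n
𝟏 _ = true

⋀ : ∀ {m} → (Fin m → Bool) → Bool
⋀ {zero}  f = true
⋀ {suc m} f = f zero ∧ ⋀ (λ i → f (suc i))

⋁ : ∀ {m} → (Fin m → Bool) → Bool
⋁ {zero}  f = false
⋁ {suc m} f = f zero ∨ ⋁ (λ i → f (suc i))

record Clause (n : ℕ) : Set where
  constructor clause
  field
    head     : Fin n
    arity    : ℕ
    body     : Fin arity → Fin n
    distinct : Injective _≡_ _≡_ body
open Clause public

Program : ℕ → Set
Program n = List (Clause n)

#cl : ∀ {n} → Program n → ℕ
#cl P = length P

cl : ∀ {n} (P : Program n) → Fin (#cl P) → Clause n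
cl P j = lookup P j

TL : ∀ {n} → Program n → Interp n → Interp n
TL P I a = ⋁ (λ j → ⌊ head (cl P j) ≟ a ⌋ ∧ ⋀ (λ p → I (body (cl P j) p)))

fact : ∀ {n} → Fin n → Clause n
fact a = clause a 0 (λ ()) (λ {x} → ⊥-fin x)
  where
  ⊥-fin : ∀ {ℓ} {A : Set ℓ} → Fin 0 → A
  ⊥-fin ()

allAtoms : ∀ n → List (Fin n)
allAtoms zero    = []
allAtoms (suc n) = zero ∷ L.map suc (allAtoms n)

withFacts : ∀ {n} → Program n → Interp n → Program n
withFacts {n} P I = P ++ L.map fact (filterᵇ I (allAtoms n))

IsLeastFixedPoint : ∀ {n} → (Interp n → Interp n) → Interp n → Set
IsLeastFixedPoint f M = (∀ a → f M a ≡ M a) × (∀ X → (∀ a → f X a ≡ X a) → M ≤ᴵ X)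

-- M is the least Herbrand model of L ∪ {→ a | I(a)=1}, i.e. M = C_L(I)
IsConsequence : ∀ {n} → Program n → Interp n → Interp n → Set
IsConsequence P I M = IsLeastFixedPoint (TL (withFacts P I)) M

Rel : Set → Set → Set₁
Rel X Y = X → Y → Set

Represents : ∀ {n} → Rel (Interp n) (Interp n) → (Interp n → Interp n) → Set
Represents R f = ∀ x y → R x y ⇔ (f x ≤ᴵ y)

Copier : (k : ℕ) → Rel Bool (Fin k → Bool)
Copier k x ys = ∀ l → x ≤ ys l

Conj : (k : ℕ) → Rel (Fin k → Bool) Bool
Conj k xs y = ⋀ xs ≤ y

CoCopier : (ℓ : ℕ) → Rel (Fin ℓ → Bool) Bool
CoCopier ℓ xs y = ∀ r → xs r ≤ y

-- The wires between the copiers and the conjunction nodes are indexed by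
-- pairs (j , p): clause j, p-th body atom of clause j.  Composition with
-- the wire permutations just re-indexes these wires.  Copier i's outputs
-- are exactly the wires (j , p) with body_j(p) = a_i; co-copier i's inputs
-- are exactly the outputs z_j of conjunction nodes of clauses with head a_i.
⟦E⟧ : ∀ {n} → Program n → Rel (Interp n) (Interp n)
⟦E⟧ P X Y =
  Σ ((j : Fin (#cl P)) → Fin (arity (cl P j)) → Bool) λ w →
  Σ (Fin (#cl P) → Bool) λ z →
      (∀ i j p → body (cl P j) p ≡ i → X i ≤ w j p)
    ×
      (∀ j → Conj (arity (cl P j)) (w j) (z j))
    ×
      (∀ i j → head (cl P j) ≡ i → z j ≤ Y i)

⟦D⟧ : ∀ {n} → Program n → Rel (Interp n) (Interp n)
⟦D⟧ {n} P I J =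
  Σ (Interp n) λ K₁ → Σ (Interp n) λ K₂ → Σ (Interp n) λ K₃ →
  Σ (Interp n) λ K₄ → Σ (Interp n) λ K₅ → Σ (Interp n) λ K₆ →
      (I ≤ᴵ K₁) × (K₆ ≤ᴵ K₁) × (K₁ ≤ᴵ K₂) × (K₁ ≤ᴵ J)
    × ⟦E⟧ P K₂ K₃
    × ((K₃ ∧ᴵ K₄) ≤ᴵ 𝟎) × (K₅ ≤ᴵ K₄) × (𝟏 ≤ᴵ (K₅ ∨ᴵ K₆))

{-# OPTIONS --safe #-}
-- Both operators are computed by the diagrams because every box is the
-- relation "f(x) ≤ y" of a monotone f, and composing such relations composes
-- the functions: the copiers and conjunction nodes compute the bodies, the
-- co-copiers the disjunction over clauses with a given head, so ⟦E_L⟧ is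
-- T_L ≤ _.  In D_L the cup 𝟏 ≤ K₅ ∨ K₆ and cap K₃ ∧ K₄ ≤ 𝟎 of the feedback
-- loop compose to the order (a snake equation), so ⟦D_L⟧ I J holds iff some
-- K ≤ J is a prefixed point of T_L above I.  The least such K is C_L(I),
-- which is reached by Kleene iteration from 𝟎 since 𝔹^At has finite height.
module Submission where

open import Defs
open import Data.Nat using (ℕ)
open import Data.Product using (Σ; _×_)
open import Function.Bundles using (_⇔_)

open import Data.Bool using (Bool; true; false; _∧_; _∨_; not; T; if_then_else_)
open import Data.Bool.Base using (b≤b; f≤t)
open import Data.Bool.Properties as 𝔹
  using (T-∧; T-∨; ≤-minimum; ≤-refl; ≤-reflexive; ≤-antisym; ∧-inverseʳ; ∨-inverseˡ)
open import Data.Empty using (⊥-elim)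
open import Data.Fin using (Fin; zero; suc; _≟_)
open import Data.List using (List; []; _∷_; _++_; map; filterᵇ)
open import Data.List.Membership.Propositional using (_∈_)
open import Data.List.Membership.Propositional.Properties using (∈-map⁺; ∈-filter⁺; ∈-filter⁻)
open import Data.List.Relation.Unary.Any using (here; there)
import Data.Nat as ℕ
open import Data.Nat.GeneralisedArithmetic using (fold)
import Data.Nat.Properties as ℕ
open import Data.Product using (_,_; proj₁; proj₂; ∃-syntax)
open import Data.Sum using (_⊎_; inj₁; inj₂; [_,_]′)
open import Data.Unit using (tt)
open import Function using (_∘_)
open import Function.Bundles using (mk⇔; Equivalence)
open import Function.Construct.Composition using (_⇔-∘_)
open import Relation.Binary.PropositionalEquality using (_≡_; refl; sym; trans; cong)
open import Relation.Nullary using (¬_; Dec; yes; no; contradiction)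
open import Relation.Nullary.Decidable using (⌊_⌋; toWitness; fromWitness)

open Equivalence using (to; from)

private
  variable
    n : ℕ

≤⇒T⇒T : ∀ {x y} → x ≤ y → T x → T y
≤⇒T⇒T b≤b t = t
≤⇒T⇒T f≤t _ = tt

T⇒T⇒≤ : ∀ {x y} → (T x → T y) → x ≤ y
T⇒T⇒≤ {false}        _ = ≤-minimum _
T⇒T⇒≤ {true} {true}  _ = b≤b
T⇒T⇒≤ {true} {false} h = ⊥-elim (h tt)

T-⋀ : ∀ {m} (f : Fin m → Bool) → T (⋀ f) ⇔ (∀ i → T (f i))
T-⋀ {ℕ.zero}  f = mk⇔ (λ _ ()) (λ _ → tt)
T-⋀ {ℕ.suc m} f = mk⇔
  (λ t → let t₀ , t₊ = to T-∧ t in λ { zero → t₀ ; (suc i) → to (T-⋀ (f ∘ suc)) t₊ i })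
  (λ h → from T-∧ (h zero , from (T-⋀ (f ∘ suc)) (h ∘ suc)))

T-⋁ : ∀ {m} (f : Fin m → Bool) → T (⋁ f) ⇔ (∃[ i ] T (f i))
T-⋁ {ℕ.zero}  f = mk⇔ (λ ()) (λ { (() , _) })
T-⋁ {ℕ.suc m} f = mk⇔
  (λ t → [ (zero ,_) , (λ t₊ → let i , tᵢ = to (T-⋁ (f ∘ suc)) t₊ in suc i , tᵢ) ]′ (to T-∨ t))
  (λ { (zero  , t) → from T-∨ (inj₁ t)
      ; (suc i , t) → from T-∨ (inj₂ (from (T-⋁ (f ∘ suc)) (i , t))) })

≤ᴵ-refl : {X : Interp n} → X ≤ᴵ X
≤ᴵ-refl a = ≤-refl

≤ᴵ-trans : {X Y Z : Interp n} → X ≤ᴵ Y → Y ≤ᴵ Z → X ≤ᴵ Z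
≤ᴵ-trans X≤Y Y≤Z a = 𝔹.≤-trans (X≤Y a) (Y≤Z a)

Fires : (P : Program n) → Interp n → Fin n → Set
Fires P X a = ∃[ j ] head (cl P j) ≡ a × (∀ p → T (X (body (cl P j) p)))

T-TL : (P : Program n) (X : Interp n) (a : Fin n) → T (TL P X a) ⇔ Fires P X a
T-TL P X a = mk⇔
  (λ t → let j , tⱼ = to (T-⋁ _) t
             h , b = to T-∧ tⱼ
         in j , toWitness h , to (T-⋀ _) b)
  (λ (j , h , b) → from (T-⋁ _) (j , from T-∧ (fromWitness h , from (T-⋀ _) b)))

TL-mono : (P : Program n) {X Y : Interp n} → X ≤ᴵ Y → TL P X ≤ᴵ TL P Y
TL-mono P {X} {Y} X≤Y a = T⇒T⇒≤ λ t →
  let j , h , b = to (T-TL P X a) t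
  in from (T-TL P Y a) (j , h , λ p → ≤⇒T⇒T (X≤Y (body (cl P j) p)) (b p))

⟦E⟧-represents-TL : (P : Program n) → Represents (⟦E⟧ P) (TL P)
⟦E⟧-represents-TL P X Y = mk⇔ ⟦E⟧⇒TL≤ TL≤⇒⟦E⟧
  where
  ⟦E⟧⇒TL≤ : ⟦E⟧ P X Y → TL P X ≤ᴵ Y
  ⟦E⟧⇒TL≤ (w , z , copy , conj , cocopy) a = T⇒T⇒≤ λ t →
    let j , h , b = to (T-TL P X a) t
        wⱼ-true = λ p → ≤⇒T⇒T (copy _ j p refl) (b p)
    in ≤⇒T⇒T (cocopy a j h) (≤⇒T⇒T (conj j) (from (T-⋀ (w j)) wⱼ-true))

  TL≤⇒⟦E⟧ : TL P X ≤ᴵ Y → ⟦E⟧ P X Y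
  TL≤⇒⟦E⟧ TL≤Y =
      (λ j p → X (body (cl P j) p))
    , (λ j → ⋀ (λ p → X (body (cl P j) p)))
    , (λ { i j p refl → ≤-refl })
    , (λ j → ≤-refl)
    , (λ i j h → T⇒T⇒≤ λ t → ≤⇒T⇒T (TL≤Y i) (from (T-TL P X i) (j , h , to (T-⋀ _) t)))

TL-++ : (P Q : Program n) (X : Interp n) (a : Fin n) →
        TL (P ++ Q) X a ≡ TL P X a ∨ TL Q X a
TL-++ []      Q X a = refl
TL-++ (c ∷ P) Q X a = trans (cong (fires-c ∨_) (TL-++ P Q X a))
                            (sym (𝔹.∨-assoc fires-c (TL P X a) (TL Q X a)))
  where
  fires-c : Bool
  fires-c = ⌊ head c ≟ a ⌋ ∧ ⋀ (λ p → X (body c p))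

T-TL-facts : (as : List (Fin n)) (X : Interp n) (a : Fin n) →
             T (TL (map fact as) X a) ⇔ a ∈ as
T-TL-facts []       X a = mk⇔ (λ ()) (λ ())
T-TL-facts (b ∷ as) X a = mk⇔
  (λ t → [ (λ t₀ → here (sym (toWitness (proj₁ (to (T-∧ {⌊ b ≟ a ⌋}) t₀)))))
         , there ∘ to (T-TL-facts as X a) ]′ (to (T-∨ {⌊ b ≟ a ⌋ ∧ true}) t))
  (λ { (here refl) → from T-∨ (inj₁ (from T-∧ (fromWitness {a? = a ≟ a} refl , tt)))
     ; (there a∈as) → from (T-∨ {⌊ b ≟ a ⌋ ∧ true}) (inj₂ (from (T-TL-facts as X a) a∈as)) })

∈-allAtoms : (a : Fin n) → a ∈ allAtoms n
∈-allAtoms zero    = here refl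
∈-allAtoms (suc a) = there (∈-map⁺ suc (∈-allAtoms a))

T-TL-withFacts : (P : Program n) (I X : Interp n) (a : Fin n) →
                 T (TL (withFacts P I) X a) ⇔ (T (TL P X a) ⊎ T (I a))
T-TL-withFacts {n} P I X a = mk⇔
  (λ t → [ inj₁ , inj₂ ∘ fact-fires⇒I ]′
           (to (T-∨ {TL P X a}) (≤⇒T⇒T (≤-reflexive TL-split) t)))
  (λ t → ≤⇒T⇒T (≤-reflexive (sym TL-split))
           (from (T-∨ {TL P X a}) ([ inj₁ , inj₂ ∘ I⇒fact-fires ]′ t)))
  where
  I? : (b : Fin n) → Dec (T (I b))
  I? = 𝔹.T? ∘ I

  atomsOfI : List (Fin n)
  atomsOfI = filterᵇ I (allAtoms n)

  TL-split : TL (withFacts P I) X a ≡ TL P X a ∨ TL (map fact atomsOfI) X a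
  TL-split = TL-++ P (map fact atomsOfI) X a

  fact-fires⇒I : T (TL (map fact atomsOfI) X a) → T (I a)
  fact-fires⇒I = proj₂ ∘ ∈-filter⁻ I? {xs = allAtoms n} ∘ to (T-TL-facts atomsOfI X a)

  I⇒fact-fires : T (I a) → T (TL (map fact atomsOfI) X a)
  I⇒fact-fires = from (T-TL-facts atomsOfI X a) ∘ ∈-filter⁺ I? (∈-allAtoms a)

prefixed-withFacts : (P : Program n) (I K : Interp n) →
                     TL (withFacts P I) K ≤ᴵ K ⇔ (I ≤ᴵ K × TL P K ≤ᴵ K)
prefixed-withFacts P I K = mk⇔
  (λ pre → (λ a → T⇒T⇒≤ (≤⇒T⇒T (pre a) ∘ from (T-TL-withFacts P I K a) ∘ inj₂))
         , (λ a → T⇒T⇒≤ (≤⇒T⇒T (pre a) ∘ from (T-TL-withFacts P I K a) ∘ inj₁)))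
  (λ (I≤K , TL≤K) a → T⇒T⇒≤ λ t →
     [ ≤⇒T⇒T (TL≤K a) , ≤⇒T⇒T (I≤K a) ]′ (to (T-TL-withFacts P I K a) t))

trueCount : Interp n → ℕ
trueCount {ℕ.zero}  X = 0
trueCount {ℕ.suc n} X = (if X zero then 1 else 0) ℕ.+ trueCount (X ∘ suc)

trueCount≤n : (X : Interp n) → trueCount X ℕ.≤ n
trueCount≤n {ℕ.zero}  X = ℕ.z≤n
trueCount≤n {ℕ.suc n} X with X zero
... | true  = ℕ.s≤s (trueCount≤n (X ∘ suc))
... | false = ℕ.m≤n⇒m≤1+n (trueCount≤n (X ∘ suc))

trueCount-mono : {X Y : Interp n} → X ≤ᴵ Y → trueCount X ℕ.≤ trueCount Y
trueCount-mono {ℕ.zero}  X≤Y = ℕ.z≤n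
trueCount-mono {ℕ.suc n} {X} {Y} X≤Y with X zero | Y zero | X≤Y zero
... | false | false | _ = trueCount-mono (X≤Y ∘ suc)
... | false | true  | _ = ℕ.m≤n⇒m≤1+n (trueCount-mono (X≤Y ∘ suc))
... | true  | true  | _ = ℕ.s≤s (trueCount-mono (X≤Y ∘ suc))

trueCount-strictMono : {X Y : Interp n} → X ≤ᴵ Y → ∀ a → ¬ (Y a ≤ X a) →
                       trueCount X ℕ.< trueCount Y
trueCount-strictMono {X = X} {Y} X≤Y zero Y≰X with X zero | Y zero | X≤Y zero
... | false | false | _ = contradiction b≤b Y≰X
... | false | true  | _ = ℕ.s≤s (trueCount-mono (X≤Y ∘ suc))
... | true  | true  | _ = contradiction b≤b Y≰X
trueCount-strictMono {X = X} {Y} X≤Y (suc a) Y≰X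
  with trueCount-strictMono (X≤Y ∘ suc) a Y≰X | X zero | Y zero | X≤Y zero
... | X₊<Y₊ | false | false | _ = X₊<Y₊
... | X₊<Y₊ | false | true  | _ = ℕ.m<n⇒m<1+n X₊<Y₊
... | X₊<Y₊ | true  | true  | _ = ℕ.s≤s X₊<Y₊

trueCount-≥⇒≥ᴵ : {X Y : Interp n} → X ≤ᴵ Y → trueCount Y ℕ.≤ trueCount X → Y ≤ᴵ X
trueCount-≥⇒≥ᴵ {X = X} {Y} X≤Y Y≤X a with Y a 𝔹.≤? X a
... | yes Yₐ≤Xₐ = Yₐ≤Xₐ
... | no  Yₐ≰Xₐ = contradiction Y≤X (ℕ.<⇒≱ (trueCount-strictMono X≤Y a Yₐ≰Xₐ))

module Kleene (f : Interp n → Interp n) (f-mono : ∀ {X Y} → X ≤ᴵ Y → f X ≤ᴵ f Y) where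

  approx : ℕ → Interp n
  approx = fold 𝟎 f

  approx-ascending : ∀ k → approx k ≤ᴵ approx (ℕ.suc k)
  approx-ascending ℕ.zero    a = ≤-minimum _
  approx-ascending (ℕ.suc k) = f-mono (approx-ascending k)

  approx-grows-or-stable : ∀ k → k ℕ.≤ trueCount (approx k) ⊎ approx (ℕ.suc k) ≤ᴵ approx k
  approx-grows-or-stable ℕ.zero = inj₁ ℕ.z≤n
  approx-grows-or-stable (ℕ.suc k) with approx-grows-or-stable k
  ... | inj₂ stable = inj₂ (f-mono stable)
  ... | inj₁ k≤count with trueCount (approx (ℕ.suc k)) ℕ.≤? trueCount (approx k)
  ...   | yes no-growth = inj₂ (f-mono (trueCount-≥⇒≥ᴵ (approx-ascending k) no-growth))
  ...   | no  growth    = inj₁ (ℕ.<-≤-trans (ℕ.s≤s k≤count) (ℕ.≰⇒> growth))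

  lfp : Interp n
  lfp = approx (ℕ.suc n)

  lfp-prefixed : f lfp ≤ᴵ lfp
  lfp-prefixed with approx-grows-or-stable (ℕ.suc n)
  ... | inj₂ stable = stable
  ... | inj₁ n<count = contradiction (trueCount≤n lfp) (ℕ.<⇒≱ n<count)

  approx-below-prefixed : ∀ {X} → f X ≤ᴵ X → ∀ k → approx k ≤ᴵ X
  approx-below-prefixed pre ℕ.zero    a = ≤-minimum _
  approx-below-prefixed pre (ℕ.suc k) = ≤ᴵ-trans (f-mono (approx-below-prefixed pre k)) pre

  lfp-least : ∀ {X} → f X ≤ᴵ X → lfp ≤ᴵ X
  lfp-least pre = approx-below-prefixed pre (ℕ.suc n)

  lfp-isLeastFixedPoint : IsLeastFixedPoint f lfp
  lfp-isLeastFixedPoint =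
      (λ a → ≤-antisym (lfp-prefixed a) (approx-ascending (ℕ.suc n) a))
    , (λ X fixed → lfp-least (≤-reflexive ∘ fixed))

  below-prefixed⇔lfp≤ : ∀ J → (∃[ K ] f K ≤ᴵ K × K ≤ᴵ J) ⇔ lfp ≤ᴵ J
  below-prefixed⇔lfp≤ J = mk⇔
    (λ (K , pre , K≤J) → ≤ᴵ-trans (lfp-least pre) K≤J)
    (λ lfp≤J → lfp , lfp-prefixed , lfp≤J)

snake : ∀ {x y z w} → (x ∧ y) ≤ false → z ≤ y → true ≤ (z ∨ w) → x ≤ w
snake {false}                              _  _  _  = ≤-minimum _
snake {true}                      {w = true} _  _  _  = b≤b
snake {true} {true}               {w = false} () _ _
snake {true} {false} {true}  {false} _ () _
snake {true} {false} {false} {false} _ _ ()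

-- Witnesses y = z = not w for the converse of snake.
snake-cap : ∀ {x w} → x ≤ w → (x ∧ not w) ≤ false
snake-cap {x} b≤b = ≤-reflexive (∧-inverseʳ x)
snake-cap     f≤t = b≤b

snake-cup : ∀ w → true ≤ (not w ∨ w)
snake-cup w = ≤-reflexive (sym (∨-inverseˡ w))

⟦D⟧⇔below-prefixed : (P : Program n) (I J : Interp n) →
  ⟦D⟧ P I J ⇔ (∃[ K ] TL (withFacts P I) K ≤ᴵ K × K ≤ᴵ J)
⟦D⟧⇔below-prefixed P I J = mk⇔
  (λ (K₁ , K₂ , K₃ , K₄ , K₅ , K₆ , I≤K₁ , K₆≤K₁ , K₁≤K₂ , K₁≤J , e , cap , K₅≤K₄ , cup) →
     let TL≤K₃ = to (⟦E⟧-represents-TL P K₂ K₃) e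
         K₃≤K₆ = λ a → snake (cap a) (K₅≤K₄ a) (cup a)
         TL≤K₁ = ≤ᴵ-trans (TL-mono P K₁≤K₂) (≤ᴵ-trans TL≤K₃ (≤ᴵ-trans K₃≤K₆ K₆≤K₁))
     in K₁ , from (prefixed-withFacts P I K₁) (I≤K₁ , TL≤K₁) , K₁≤J)
  (λ (K , pre , K≤J) →
     let I≤K , TL≤K = to (prefixed-withFacts P I K) pre
     in K , K , TL P K , not ∘ K , not ∘ K , K
      , I≤K , ≤ᴵ-refl , ≤ᴵ-refl , K≤J
      , from (⟦E⟧-represents-TL P K (TL P K)) ≤ᴵ-refl
      , (λ a → snake-cap (TL≤K a)) , ≤ᴵ-refl , (λ a → snake-cup (K a)))

mainTheorem1 : (n : ℕ) (P : Program n) →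
    Represents (⟦E⟧ P) (TL P)
    × ((I : Interp n) → Σ (Interp n) λ M →
         IsConsequence P I M × (∀ J → ⟦D⟧ P I J ⇔ (M ≤ᴵ J)))
mainTheorem1 n P = ⟦E⟧-represents-TL P , λ I →
  let open Kleene (TL (withFacts P I)) (TL-mono (withFacts P I))
  in lfp , lfp-isLeastFixedPoint , λ J →
       below-prefixed⇔lfp≤ J ⇔-∘ ⟦D⟧⇔below-prefixed P I J
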